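{- Let $n\ge1$ and let $d=(d_1\le\cdots\le d_k)$ be a sequence of nonnegative integers with $\sum_i d_i=\binom{n+1}{2}$ and $$d_{k-i}\ge n-i,\qquad i=0,\dots,k-1.$$ Then there is a matrix $A\in\mathcal N(d,n^-)$ such that $a_{ij}\ge1$ for every position $(i,j)$ with $i+j\ge k+1$.
   Context: $n^-$ denotes the sequence $(1,2,\dots,n)$. For nonnegative integer sequences $d=(d_1,\dots,d_k)$ and $b=(b_1,\dots,b_n)$ with equal sums, $\mathcal N(d,b)$ is the set of $k\times n$ matrices with nonnegative integer entries whose $i$-th row sum is $d_i$ for each $i$ and whose $j$-th column sum is $b_j$ for each $j$. -}

module Defs where

open import Data.Nat using (ℕ; zero; suc; _+_; _≤_; _∸_)
open import Data.Fin using (Fin; zero; suc; toℕ)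
open import Data.Product using (Σ; _×_)
open import Relation.Binary.PropositionalEquality using (_≡_)

∑ : {m : ℕ} → (Fin m → ℕ) → ℕ
∑ {zero}  f = 0
∑ {suc m} f = f zero + ∑ (λ i → f (suc i))

𝒩 : {k n : ℕ} → (Fin k → ℕ) → (Fin n → ℕ) → Set
𝒩 {k} {n} d b =
  Σ (Fin k → Fin n → ℕ) λ A →
    ((i : Fin k) → ∑ (λ j → A i j) ≡ d i) × ((j : Fin n) → ∑ (λ i → A i j) ≡ b j)

n⁻ : (n : ℕ) → Fin n → ℕ
n⁻ n j = suc (toℕ j)

module Submission where

-- Let B be the 0/1 "staircase" matrix with B i j = 1
-- exactly when k ≤ i + j + 1 (0-based indices).  Its i-th row sum is
-- n ∸ (k ∸ (i+1)) = n ∸ toℕ (opposite i), which is at most d i by hypothesis,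
-- and its j-th column sum is k ∸ (k ∸ (j+1)) ≤ j + 1.  Since
-- ∑ d = (n+1) choose 2 = 1 + 2 + ... + n, the residual margins d ∸ (row sums
-- of B) and n⁻ ∸ (column sums of B) have equal totals, and every pair of
-- margins with equal totals is realised by some nonnegative integer matrix
-- (the north-west corner rule).  Adding that matrix to B gives the result.

open import Defs
open import Data.Nat using (ℕ; zero; suc; _+_; _≤_; _∸_; _≤?_; z≤n; s≤s)
open import Data.Nat.Properties
open import Data.Nat.Combinatorics using (_C_; nCk+nC[k+1]≡[n+1]C[k+1]; nC1≡n)
open import Data.Fin using (Fin; toℕ; opposite) renaming (_≤_ to _≤ᶠ_; zero to fz; suc to fs)
open import Data.Fin.Properties using (opposite-prop; opposite-involutive)
open import Data.Vec.Functional using (_∷_; tail)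
open import Data.Product using (Σ; proj₁; proj₂; _,_)
open import Relation.Binary.PropositionalEquality
open import Relation.Nullary using (yes; no)
open import Algebra.Properties.CommutativeSemigroup +-commutativeSemigroup using (interchange)

∑-cong : ∀ {m} {f g : Fin m → ℕ} → (∀ i → f i ≡ g i) → ∑ f ≡ ∑ g
∑-cong {zero}  e = refl
∑-cong {suc m} e = cong₂ _+_ (e fz) (∑-cong (λ i → e (fs i)))

∑-zeros : ∀ m → ∑ {m} (λ _ → 0) ≡ 0
∑-zeros zero    = refl
∑-zeros (suc m) = ∑-zeros m

∑-ones : ∀ m → ∑ {m} (λ _ → 1) ≡ m
∑-ones zero    = refl
∑-ones (suc m) = cong suc (∑-ones m)

∑-+ : ∀ {m} (f g : Fin m → ℕ) → ∑ (λ i → f i + g i) ≡ ∑ f + ∑ g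
∑-+ {zero}  f g = refl
∑-+ {suc m} f g = begin
  (f fz + g fz) + ∑ (λ i → tail f i + tail g i) ≡⟨ cong ((f fz + g fz) +_) (∑-+ (tail f) (tail g)) ⟩
  (f fz + g fz) + (∑ (tail f) + ∑ (tail g))     ≡⟨ interchange (f fz) (g fz) (∑ (tail f)) (∑ (tail g)) ⟩
  (f fz + ∑ (tail f)) + (g fz + ∑ (tail g))     ∎
  where open ≡-Reasoning

∑-suc : ∀ {m} (f : Fin m → ℕ) → ∑ (λ i → suc (f i)) ≡ m + ∑ f
∑-suc {m} f = trans (∑-+ (λ _ → 1) f) (cong (_+ ∑ f) (∑-ones m))

∑-swap : ∀ {k n} (A : Fin k → Fin n → ℕ) →
         ∑ (λ i → ∑ (λ j → A i j)) ≡ ∑ (λ j → ∑ (λ i → A i j))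
∑-swap {zero}  {n} A = sym (∑-zeros n)
∑-swap {suc k}     A = trans (cong (∑ (A fz) +_) (∑-swap (tail A)))
                             (sym (∑-+ (A fz) (λ j → ∑ (λ i → A (fs i) j))))

∑≡0⇒≡0 : ∀ {m} (f : Fin m → ℕ) → ∑ f ≡ 0 → ∀ i → f i ≡ 0
∑≡0⇒≡0 f e fz     = m+n≡0⇒m≡0 (f fz) e
∑≡0⇒≡0 f e (fs i) = ∑≡0⇒≡0 (tail f) (m+n≡0⇒n≡0 (f fz) e) i

∑-∸ : ∀ {m} (f g : Fin m → ℕ) → (∀ i → g i ≤ f i) →
      ∑ (λ i → f i ∸ g i) ≡ ∑ f ∸ ∑ g
∑-∸ f g g≤f = begin
  ∑ (λ i → f i ∸ g i)                   ≡⟨ sym (m+n∸n≡m _ (∑ g)) ⟩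
  ∑ (λ i → f i ∸ g i) + ∑ g ∸ ∑ g       ≡⟨ cong (_∸ ∑ g) (sym (∑-+ (λ i → f i ∸ g i) g)) ⟩
  ∑ (λ i → f i ∸ g i + g i) ∸ ∑ g       ≡⟨ cong (_∸ ∑ g) (∑-cong (λ i → m∸n+n≡m (g≤f i))) ⟩
  ∑ f ∸ ∑ g                             ∎
  where open ≡-Reasoning

transpose : ∀ {k n} {x : Fin k → ℕ} {y : Fin n → ℕ} → 𝒩 x y → 𝒩 y x
transpose (A , rows , cols) = (λ j i → A i j) , cols , rows

-- North-west corner step: if the first row demand fits into the first
-- column, put all of it in the corner and realise the rest of the rows
-- against the reduced columns.
extendRow : ∀ {k n} {x : Fin (suc k) → ℕ} {y : Fin (suc n) → ℕ} →
            x fz ≤ y fz → 𝒩 (tail x) ((y fz ∸ x fz) ∷ tail y) → 𝒩 x y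
extendRow {n = n} {x} {y} x₀≤y₀ (G , rows , cols) = A , rowsA , colsA
  where
  A : Fin _ → Fin _ → ℕ
  A = (x fz ∷ λ _ → 0) ∷ G

  rowsA : ∀ i → ∑ (A i) ≡ x i
  rowsA fz     = trans (cong (x fz +_) (∑-zeros n)) (+-identityʳ (x fz))
  rowsA (fs i) = rows i

  colsA : ∀ j → ∑ (λ i → A i j) ≡ y j
  colsA fz     = trans (cong (x fz +_) (cols fz)) (m+[n∸m]≡n x₀≤y₀)
  colsA (fs j) = cols (fs j)

extendCol : ∀ {k n} {x : Fin (suc k) → ℕ} {y : Fin (suc n) → ℕ} →
            y fz ≤ x fz → 𝒩 ((x fz ∸ y fz) ∷ tail x) (tail y) → 𝒩 x y
extendCol y₀≤x₀ G = transpose (extendRow y₀≤x₀ (transpose G))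

cancel-head : ∀ {a b s t} → a ≤ b → a + s ≡ b + t → s ≡ (b ∸ a) + t
cancel-head {a} {b} {s} {t} a≤b e = +-cancelˡ-≡ a s ((b ∸ a) + t) (begin
  a + s             ≡⟨ e ⟩
  b + t             ≡⟨ cong (_+ t) (sym (m+[n∸m]≡n a≤b)) ⟩
  a + (b ∸ a) + t   ≡⟨ +-assoc a (b ∸ a) t ⟩
  a + ((b ∸ a) + t) ∎)
  where open ≡-Reasoning

transport : ∀ k n (x : Fin k → ℕ) (y : Fin n → ℕ) → ∑ x ≡ ∑ y → 𝒩 x y
transport zero    n       x y e = (λ ()) , (λ ()) , (λ j → sym (∑≡0⇒≡0 y (sym e) j))
transport (suc k) zero    x y e = transpose (transport zero (suc k) y x (sym e))
transport (suc k) (suc n) x y e with x fz ≤? y fz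
... | yes x₀≤y₀ = extendRow x₀≤y₀
      (transport k (suc n) (tail x) _ (cancel-head x₀≤y₀ e))
... | no  x₀≰y₀ = extendCol (≰⇒≥ x₀≰y₀)
      (transport (suc k) n _ (tail y) (sym (cancel-head (≰⇒≥ x₀≰y₀) (sym e))))

complete : ∀ {k n} (x : Fin k → ℕ) (y : Fin n → ℕ) (B : Fin k → Fin n → ℕ) →
           (∀ i → ∑ (B i) ≤ x i) → (∀ j → ∑ (λ i → B i j) ≤ y j) →
           ∑ x ≡ ∑ y →
           Σ (𝒩 x y) λ A → ∀ i j → B i j ≤ proj₁ A i j
complete {k} {n} x y B rowsB≤x colsB≤y e =
  ((λ i j → B i j + G i j) , rows , cols) , λ i j → m≤m+n (B i j) (G i j)
  where
  open ≡-Reasoning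
  r : Fin k → ℕ
  r i = ∑ (B i)
  s : Fin n → ℕ
  s j = ∑ (λ i → B i j)

  residuals-balance : ∑ (λ i → x i ∸ r i) ≡ ∑ (λ j → y j ∸ s j)
  residuals-balance = begin
    ∑ (λ i → x i ∸ r i) ≡⟨ ∑-∸ x r rowsB≤x ⟩
    ∑ x ∸ ∑ r           ≡⟨ cong₂ _∸_ e (∑-swap B) ⟩
    ∑ y ∸ ∑ s           ≡⟨ sym (∑-∸ y s colsB≤y) ⟩
    ∑ (λ j → y j ∸ s j) ∎

  residual : 𝒩 (λ i → x i ∸ r i) (λ j → y j ∸ s j)
  residual = transport k n _ _ residuals-balance

  G : Fin k → Fin n → ℕ
  G = proj₁ residual

  rows : ∀ i → ∑ (λ j → B i j + G i j) ≡ x i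
  rows i = begin
    ∑ (λ j → B i j + G i j) ≡⟨ ∑-+ (B i) (G i) ⟩
    r i + ∑ (G i)           ≡⟨ cong (r i +_) (proj₁ (proj₂ residual) i) ⟩
    r i + (x i ∸ r i)       ≡⟨ m+[n∸m]≡n (rowsB≤x i) ⟩
    x i                     ∎

  cols : ∀ j → ∑ (λ i → B i j + G i j) ≡ y j
  cols j = begin
    ∑ (λ i → B i j + G i j) ≡⟨ ∑-+ (λ i → B i j) (λ i → G i j) ⟩
    s j + ∑ (λ i → G i j)   ≡⟨ cong (s j +_) (proj₂ (proj₂ residual) j) ⟩
    s j + (y j ∸ s j)       ≡⟨ m+[n∸m]≡n (colsB≤y j) ⟩
    y j                     ∎

𝟙[_≤_] : ℕ → ℕ → ℕ
𝟙[ zero  ≤ m     ] = 1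
𝟙[ suc K ≤ zero  ] = 0
𝟙[ suc K ≤ suc m ] = 𝟙[ K ≤ m ]

𝟙-pos : ∀ {K m} → K ≤ m → 1 ≤ 𝟙[ K ≤ m ]
𝟙-pos z≤n       = s≤s z≤n
𝟙-pos (s≤s K≤m) = 𝟙-pos K≤m

count : ∀ K c n → ∑ {n} (λ j → 𝟙[ K ≤ toℕ j + c ]) ≡ n ∸ (K ∸ c)
count K c zero    = sym (0∸n≡0 (K ∸ c))
count K c (suc n) = begin
  𝟙[ K ≤ c ] + ∑ {n} (λ j → 𝟙[ K ≤ suc (toℕ j + c) ])
    ≡⟨ cong (𝟙[ K ≤ c ] +_) (∑-cong {n} (λ j → cong 𝟙[ K ≤_] (sym (+-suc (toℕ j) c)))) ⟩
  𝟙[ K ≤ c ] + ∑ {n} (λ j → 𝟙[ K ≤ toℕ j + suc c ])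
    ≡⟨ cong (𝟙[ K ≤ c ] +_) (count K (suc c) n) ⟩
  𝟙[ K ≤ c ] + (n ∸ (K ∸ suc c))
    ≡⟨ shift K c ⟩
  suc n ∸ (K ∸ c) ∎
  where
  open ≡-Reasoning
  shift : ∀ K c → 𝟙[ K ≤ c ] + (n ∸ (K ∸ suc c)) ≡ suc n ∸ (K ∸ c)
  shift zero    zero    = refl
  shift zero    (suc c) = refl
  shift (suc K) zero    = refl
  shift (suc K) (suc c) = shift K c

staircase : ∀ k n → Fin k → Fin n → ℕ
staircase k n i j = 𝟙[ k ≤ toℕ j + suc (toℕ i) ]

-- Row i of the staircase has n ∸ (k ∸ (i+1)) = n ∸ toℕ (opposite i) ones,
-- which is exactly the lower bound the theorem assumes on d i.
staircase-row : ∀ k n (i : Fin k) → ∑ (staircase k n i) ≡ n ∸ toℕ (opposite i)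
staircase-row k n i = trans (count k (suc (toℕ i)) n) (cong (n ∸_) (sym (opposite-prop i)))

staircase-col : ∀ k n (j : Fin n) → ∑ (λ i → staircase k n i j) ≤ suc (toℕ j)
staircase-col k n j = begin
  ∑ {k} (λ i → 𝟙[ k ≤ toℕ j + suc (toℕ i) ]) ≡⟨ ∑-cong {k} (λ i → cong 𝟙[ k ≤_] (swap-suc (toℕ j) (toℕ i))) ⟩
  ∑ {k} (λ i → 𝟙[ k ≤ toℕ i + suc (toℕ j) ]) ≡⟨ count k (suc (toℕ j)) k ⟩
  k ∸ (k ∸ suc (toℕ j))                       ≤⟨ m∸[m∸n]≤n k (suc (toℕ j)) ⟩
  suc (toℕ j)                                 ∎
  where
  open ≤-Reasoning
  swap-suc : ∀ a b → a + suc b ≡ b + suc a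
  swap-suc a b = trans (+-suc a b) (trans (cong suc (+-comm a b)) (sym (+-suc b a)))
  m∸[m∸n]≤n : ∀ m n → m ∸ (m ∸ n) ≤ n
  m∸[m∸n]≤n m n = m≤n+o⇒m∸n≤o m (m ∸ n) (subst (m ≤_) (+-comm n (m ∸ n)) (m≤n+m∸n m n))

∑n⁻ : ∀ n → ∑ (n⁻ n) ≡ suc n C 2
∑n⁻ zero    = refl
∑n⁻ (suc n) = begin
  suc (∑ {n} (λ j → suc (suc (toℕ j)))) ≡⟨ cong suc (∑-suc (n⁻ n)) ⟩
  suc n + ∑ (n⁻ n)                      ≡⟨ cong (_+ ∑ (n⁻ n)) (sym (nC1≡n (suc n))) ⟩
  suc n C 1 + ∑ (n⁻ n)                  ≡⟨ cong (suc n C 1 +_) (∑n⁻ n) ⟩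
  suc n C 1 + suc n C 2                 ≡⟨ nCk+nC[k+1]≡[n+1]C[k+1] (suc n) 1 ⟩
  suc (suc n) C 2                       ∎
  where open ≡-Reasoning

lemma3 : (n k : ℕ) → 1 ≤ n → (d : Fin k → ℕ) →
    ((i j : Fin k) → i ≤ᶠ j → d i ≤ d j) →
    ∑ d ≡ suc n C 2 →
    ((i : Fin k) → n ∸ toℕ i ≤ d (opposite i)) →
    Σ (𝒩 d (n⁻ n)) λ A →
    (i : Fin k) (j : Fin n) → k ≤ toℕ i + toℕ j + 1 → 1 ≤ proj₁ A i j
lemma3 n k _ d _ ∑d hyp = proj₁ extension , positive
  where
  rows≤d : ∀ i → ∑ (staircase k n i) ≤ d i
  rows≤d i = subst₂ _≤_ (sym (staircase-row k n i)) (cong d (opposite-involutive i)) (hyp (opposite i))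

  totals : ∑ d ≡ ∑ (n⁻ n)
  totals = trans ∑d (sym (∑n⁻ n))

  extension : Σ (𝒩 d (n⁻ n)) λ A → ∀ i j → staircase k n i j ≤ proj₁ A i j
  extension = complete d (n⁻ n) (staircase k n) rows≤d (staircase-col k n) totals

  i+j+1≡j+[1+i] : ∀ a b → a + b + 1 ≡ b + suc a
  i+j+1≡j+[1+i] a b = trans (+-comm (a + b) 1) (trans (cong suc (+-comm a b)) (sym (+-suc b a)))

  positive : ∀ i j → k ≤ toℕ i + toℕ j + 1 → 1 ≤ proj₁ (proj₁ extension) i j
  positive i j k≤i+j+1 =
    ≤-trans (𝟙-pos (subst (k ≤_) (i+j+1≡j+[1+i] (toℕ i) (toℕ j)) k≤i+j+1)) (proj₂ extension i j)
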